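{- Let $\mathbf{x}\in\mathcal{A}^{\mathbb{N}}$ be $P$-power-free for an integer $P\ge1$. Then $|v|_u\le\frac{P|v|}{|u|}$ for all $u,v\in\mathcal{L}(\mathbf{x})$ with $u$ nonempty.
   Context: $\mathcal{L}(\mathbf{x})$ is the set of finite factors of $\mathbf{x}$; $|v|_u$ is the number of (possibly overlapping) occurrences of $u$ in $v$; $P$-power-free means no factor of the form $z^P$ with $z$ nonempty. -}

module Defs where

open import Data.Nat using (ℕ; zero; suc; _+_)
open import Data.List using (List; []; _∷_; length; _++_; drop)
open import Data.Product using (∃)
open import Relation.Binary.PropositionalEquality using (_≡_)
open import Relation.Binary.Definitions using (DecidableEquality)
open import Relation.Nullary using (¬_; yes; no)
open import Relation.Nullary.Decidable using (⌊_⌋)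
open import Data.Bool using (Bool; true; false; if_then_else_)

factorAt : {A : Set} → (ℕ → A) → ℕ → ℕ → List A
factorAt x i zero = []
factorAt x i (suc n) = x i ∷ factorAt x (suc i) n

InLang : {A : Set} → (ℕ → A) → List A → Set
InLang x w = ∃ λ i → w ≡ factorAt x i (length w)

_^^_ : {A : Set} → List A → ℕ → List A
z ^^ zero = []
z ^^ suc k = z ++ (z ^^ k)

PowerFree : {A : Set} → ℕ → (ℕ → A) → Set
PowerFree {A} P x = (z : List A) → ¬ (z ≡ []) → ¬ InLang x (z ^^ P)

module _ {A : Set} (_≟_ : DecidableEquality A) where

  isPrefix : List A → List A → Bool
  isPrefix [] v = true
  isPrefix (a ∷ u) [] = false
  isPrefix (a ∷ u) (b ∷ v) = if ⌊ a ≟ b ⌋ then isPrefix u v else false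

  -- |v|_u : number of (possibly overlapping) occurrences of u in v,
  -- i.e. number of positions j (0 ≤ j ≤ |v|) such that u is a prefix of drop j v
  occ : List A → List A → ℕ
  occ u [] = if isPrefix u [] then 1 else 0
  occ u (b ∷ v) = (if isPrefix u (b ∷ v) then 1 else 0) + occ u v

{-# OPTIONS --safe #-}
-- If u occurs in x at positions i and i + t, then x has period t on [i, i + t + |u|), so
-- x[i, i + tP) = (x[i, i + t))^P as soon as tP ≤ t + |u|. In a P-power-free word, two
-- occurrences of u are therefore at least g = ⌈|u|/P⌉ apart, and since g ≤ |u| a window of
-- length n holds at most n/g of them: |v|_u · |u| ≤ |v|_u · g · P ≤ P · |v|.
module Submission where

open import Defs
open import Data.Nat using (ℕ; zero; suc; _+_; _*_; _≤_; _<_; z≤n; s≤s; z<s; NonZero; >-nonZero)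
open import Data.Nat.Properties
open import Data.Nat.DivMod using (_/_; _%_; m≡m%n+[m/n]*n; m%n<n; m/n*n≤m; m/n≤m)
open import Data.Nat.Induction using (<-wellFounded)
open import Induction.WellFounded using (Acc; acc)
open import Data.List using (List; []; _∷_; length; _++_)
open import Data.List.Properties using (∷-injectiveˡ; ∷-injectiveʳ)
open import Data.Product using (_×_; _,_; proj₂)
open import Data.Bool using (true; false)
open import Data.Empty using (⊥; ⊥-elim)
open import Function using (_∘′_)
open import Relation.Binary.PropositionalEquality
open import Relation.Binary.Definitions using (DecidableEquality)
open import Relation.Nullary using (¬_; yes; no)

m<[1+m/n]*n : ∀ m n .{{_ : NonZero n}} → m < suc (m / n) * n
m<[1+m/n]*n m n = begin-strict
  m                   ≡⟨ m≡m%n+[m/n]*n m n ⟩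
  m % n + (m / n) * n <⟨ +-monoˡ-< ((m / n) * n) (m%n<n m n) ⟩
  n + (m / n) * n     ∎
  where open ≤-Reasoning

m<1+n/o⇒m*o≤n : ∀ {m} n o .{{_ : NonZero o}} → m < suc (n / o) → m * o ≤ n
m<1+n/o⇒m*o≤n n o (s≤s m≤n/o) = ≤-trans (*-monoˡ-≤ o m≤n/o) (m/n*n≤m n o)

module _ {A : Set} (x : ℕ → A) where

  OccursAt : List A → ℕ → Set
  OccursAt u i = u ≡ factorAt x i (length u)

  OccurrencesApart : ℕ → List A → Set
  OccurrencesApart g u = ∀ {i t} → 0 < t → t < g → OccursAt u i → OccursAt u (i + t) → ⊥

  length-factorAt : ∀ i n → length (factorAt x i n) ≡ n
  length-factorAt i zero    = refl
  length-factorAt i (suc n) = cong suc (length-factorAt (suc i) n)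

  factorAt∈L : ∀ i n → InLang x (factorAt x i n)
  factorAt∈L i n = i , cong (factorAt x i) (sym (length-factorAt i n))

  factorAt-+ : ∀ i m n → factorAt x i (m + n) ≡ factorAt x i m ++ factorAt x (i + m) n
  factorAt-+ i zero    n rewrite +-identityʳ i = refl
  factorAt-+ i (suc m) n rewrite +-suc i m = cong (x i ∷_) (factorAt-+ (suc i) m n)

  factorAt-≡-shorten : ∀ {i j m n} → m ≤ n → factorAt x i n ≡ factorAt x j n →
                       factorAt x i m ≡ factorAt x j m
  factorAt-≡-shorten z≤n       _  = refl
  factorAt-≡-shorten (s≤s m≤n) eq =
    cong₂ _∷_ (∷-injectiveˡ eq) (factorAt-≡-shorten m≤n (∷-injectiveʳ eq))

  factorAt-periodic : ∀ {i t m} → factorAt x (i + t) m ≡ factorAt x i m →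
                      ∀ q → t * q ≤ t + m → factorAt x i (t * q) ≡ factorAt x i t ^^ q
  factorAt-periodic {i} {t} period zero _ rewrite *-zeroʳ t = refl
  factorAt-periodic {i} {t} {m} period (suc q) t[1+q]≤t+m = begin
    factorAt x i (t * suc q)
      ≡⟨ cong (factorAt x i) (*-suc t q) ⟩
    factorAt x i (t + t * q)
      ≡⟨ factorAt-+ i t (t * q) ⟩
    factorAt x i t ++ factorAt x (i + t) (t * q)
      ≡⟨ cong (factorAt x i t ++_) (factorAt-≡-shorten tq≤m period) ⟩
    factorAt x i t ++ factorAt x i (t * q)
      ≡⟨ cong (factorAt x i t ++_) (factorAt-periodic period q tq≤t+m) ⟩
    factorAt x i t ++ factorAt x i t ^^ q
      ∎
    where
    open ≡-Reasoning
    tq≤m : t * q ≤ m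
    tq≤m = +-cancelˡ-≤ t (t * q) m (subst (_≤ t + m) (*-suc t q) t[1+q]≤t+m)
    tq≤t+m : t * q ≤ t + m
    tq≤t+m = ≤-trans tq≤m (m≤n+m m t)

  overlapping-occurrences⇒power : ∀ {u i t} q → OccursAt u i → OccursAt u (i + t) →
                                  t * q ≤ t + length u → InLang x (factorAt x i t ^^ q)
  overlapping-occurrences⇒power {i = i} {t} q occᵢ occᵢ₊ₜ tq≤t+|u| =
    subst (InLang x) (factorAt-periodic (trans (sym occᵢ₊ₜ) occᵢ) q tq≤t+|u|) (factorAt∈L i (t * q))

  -- suc (|w| / P) = ⌈|a ∷ w| / P⌉
  PowerFree⇒OccurrencesApart : ∀ {P} .{{_ : NonZero P}} → PowerFree P x →
                               ∀ a w → OccurrencesApart (suc (length w / P)) (a ∷ w)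
  PowerFree⇒OccurrencesApart {P} powerFree a w {i} {suc t} _ t<g occᵢ occᵢ₊ₜ =
    powerFree (factorAt x i (suc t)) (λ ()) (overlapping-occurrences⇒power P occᵢ occᵢ₊ₜ tP≤t+|u|)
    where
    tP≤t+|u| : suc t * P ≤ suc t + length (a ∷ w)
    tP≤t+|u| = ≤-trans (m<1+n/o⇒m*o≤n (length w) P t<g) (≤-trans (n≤1+n _) (m≤n+m _ (suc t)))

module _ {A : Set} (_≟_ : DecidableEquality A) (x : ℕ → A) where

  isPrefix-factorAt⇒OccursAt : ∀ u {i n} → isPrefix _≟_ u (factorAt x i n) ≡ true →
                               length u ≤ n × OccursAt x u i
  isPrefix-factorAt⇒OccursAt []      _ = z≤n , refl
  isPrefix-factorAt⇒OccursAt (a ∷ u) {n = zero} ()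
  isPrefix-factorAt⇒OccursAt (a ∷ u) {i} {suc n} e with a ≟ x i
  ... | yes refl = let |u|≤n , occ = isPrefix-factorAt⇒OccursAt u e in s≤s |u|≤n , cong (a ∷_) occ
  isPrefix-factorAt⇒OccursAt (a ∷ u) {i} {suc n} () | no _

  occ-[] : ∀ {u} → ¬ u ≡ [] → occ _≟_ u [] ≡ 0
  occ-[] {[]}    u≢[] = ⊥-elim (u≢[] refl)
  occ-[] {_ ∷ _} _    = refl

  occ-skip : ∀ u {i} s n → (∀ {t} → t < s → ¬ OccursAt x u (i + t)) →
             occ _≟_ u (factorAt x i (s + n)) ≡ occ _≟_ u (factorAt x (i + s) n)
  occ-skip u {i} zero    n _ rewrite +-identityʳ i = refl
  occ-skip u {i} (suc s) n free with isPrefix _≟_ u (factorAt x i (suc s + n)) in e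
  ... | true  = ⊥-elim (free z<s (subst (OccursAt x u) (sym (+-identityʳ i))
                                         (proj₂ (isPrefix-factorAt⇒OccursAt u e))))
  ... | false rewrite +-suc i s =
    occ-skip u s n (λ {t} t<s → subst (λ j → ¬ OccursAt x u j) (+-suc i t) (free (s≤s t<s)))

  occ[factorAt]*g≤n : ∀ {u g} → ¬ u ≡ [] → g ≤ length u → OccurrencesApart x g u →
                      ∀ i n → occ _≟_ u (factorAt x i n) * g ≤ n
  occ[factorAt]*g≤n {u} {zero}  _    _     _     i n =
    ≤-trans (≤-reflexive (*-zeroʳ (occ _≟_ u (factorAt x i n)))) z≤n
  occ[factorAt]*g≤n {u} {suc h} u≢[] g≤|u| apart i n = go i n (<-wellFounded n)
    where
    go : ∀ i n → Acc _<_ n → occ _≟_ u (factorAt x i n) * suc h ≤ n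
    go i zero    _ rewrite occ-[] u≢[] = z≤n
    go i (suc m) (acc rec) with isPrefix _≟_ u (factorAt x i (suc m)) in e
    ... | false = m≤n⇒m≤1+n (go (suc i) m (rec ≤-refl))
    ... | true with isPrefix-factorAt⇒OccursAt u e
    ...   | |u|≤1+m , occᵢ with m≤n⇒∃[o]m+o≡n (≤-pred (≤-trans g≤|u| |u|≤1+m))
    ...     | r , refl = begin
      suc (occ _≟_ u (factorAt x (suc i) (h + r))) * suc h
        ≡⟨ cong (λ c → suc c * suc h) (occ-skip u h r no-occurrence) ⟩
      suc h + occ _≟_ u (factorAt x (suc i + h) r) * suc h
        ≤⟨ +-monoʳ-≤ (suc h) (go (suc i + h) r (rec (s≤s (m≤n+m r h)))) ⟩
      suc h + r
        ∎
      where
      open ≤-Reasoning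
      no-occurrence : ∀ {t} → t < h → ¬ OccursAt x u (suc i + t)
      no-occurrence {t} t<h = apart z<s (s≤s t<h) occᵢ ∘′ subst (OccursAt x u) (sym (+-suc i t))

  occ[factorAt]*|u|≤P*n : ∀ {P} .{{_ : NonZero P}} → PowerFree P x →
                          ∀ u → ¬ u ≡ [] → ∀ i n → occ _≟_ u (factorAt x i n) * length u ≤ P * n
  occ[factorAt]*|u|≤P*n _ [] u≢[] = ⊥-elim (u≢[] refl)
  occ[factorAt]*|u|≤P*n {P} powerFree (a ∷ w) u≢[] i n = begin
    k * length (a ∷ w)  ≤⟨ *-monoʳ-≤ k (m<[1+m/n]*n (length w) P) ⟩
    k * (g * P)         ≡⟨ *-assoc k g P ⟨
    k * g * P           ≤⟨ *-monoˡ-≤ P (occ[factorAt]*g≤n u≢[] g≤|u| apart i n) ⟩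
    n * P               ≡⟨ *-comm n P ⟩
    P * n               ∎
    where
    open ≤-Reasoning
    k : ℕ
    k = occ _≟_ (a ∷ w) (factorAt x i n)
    g : ℕ
    g = suc (length w / P)
    g≤|u| : g ≤ length (a ∷ w)
    g≤|u| = s≤s (m/n≤m (length w) P)
    apart : OccurrencesApart x g (a ∷ w)
    apart = PowerFree⇒OccurrencesApart x powerFree a w

lemma4p11 : {A : Set} (_≟_ : DecidableEquality A) (P : ℕ) → 1 ≤ P →
    (x : ℕ → A) → PowerFree P x →
    (u v : List A) → InLang x u → InLang x v → ¬ (u ≡ []) →
    occ _≟_ u v * length u ≤ P * length v
lemma4p11 _≟_ P 1≤P x powerFree u v _ (i , v≡factor) u≢[] =
  subst (λ w → occ _≟_ u w * length u ≤ P * length v) (sym v≡factor)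
        (occ[factorAt]*|u|≤P*n _≟_ x powerFree u u≢[] i (length v))
  where instance _ = >-nonZero 1≤P
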